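{- For any connected graph $G$ with $n\geq 3$ vertices and $m$ edges, $\gamma_{\rm wcon}(G)\leq 2m-n$, with equality if and only if $G$ is a path or a cycle $C_p$ with $p\geq 7$.
   Context: Graphs are finite, simple, undirected. A set $X\subseteq V(G)$ is weakly convex if for any two vertices $a,b\in X$ there is a shortest $(a-b)$-path in $G$ all of whose vertices lie in $X$; it is dominating if every vertex outside $X$ has a neighbour in $X$. $\gamma_{\rm wcon}(G)$ is the minimum cardinality of a weakly convex dominating set of $G$. -}

module Defs where

open import Data.Nat using (ℕ; zero; suc; _+_; _*_; _∸_; _≤_; _<ᵇ_; _≡ᵇ_; _%_)
open import Data.Bool using (Bool; true; false; T; _∧_; _∨_; if_then_else_)
open import Data.Fin using (Fin; toℕ)
open import Data.Fin.Subset using (Subset; _∈_; _∉_)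
open import Data.List using (List; map; allFin)
open import Data.Nat.ListAction using (sum)
open import Data.Product using (Σ; ∃; _×_; _,_)
open import Function.Bundles using (_⤖_; Bijection)
open import Relation.Binary.PropositionalEquality using (_≡_)

record Graph (n : ℕ) : Set where
  field
    adj    : Fin n → Fin n → Bool
    sym    : ∀ i j → adj i j ≡ adj j i
    irrefl : ∀ i → adj i i ≡ false

open Graph public

Adj : ∀ {n} → Graph n → Fin n → Fin n → Set
Adj G i j = T (adj G i j)

edgeCount : ∀ {n} → Graph n → ℕ
edgeCount {n} G =
  sum (map (λ i → sum (map (λ j → if (toℕ i <ᵇ toℕ j) ∧ adj G i j then 1 else 0)
                           (allFin n)))
           (allFin n))

data Walk {n : ℕ} (G : Graph n) : Fin n → Fin n → Set where
  []  : ∀ {a} → Walk G a a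
  _∷_ : ∀ {a b c} → Adj G a b → Walk G b c → Walk G a c

wlen : ∀ {n} {G : Graph n} {a b} → Walk G a b → ℕ
wlen []      = 0
wlen (_ ∷ w) = suc (wlen w)

WalkIn : ∀ {n} {G : Graph n} {a b} → Subset n → Walk G a b → Set
WalkIn X ([] {a})    = a ∈ X
WalkIn X (_∷_ {a} _ w) = a ∈ X × WalkIn X w

-- w is a shortest (a-b)-walk (hence a shortest (a-b)-path) in G
IsShortest : ∀ {n} {G : Graph n} {a b} → Walk G a b → Set
IsShortest {G = G} {a} {b} w = ∀ (w' : Walk G a b) → wlen w ≤ wlen w'

Connected : ∀ {n} → Graph n → Set
Connected {n} G = ∀ (a b : Fin n) → Walk G a b

WeaklyConvex : ∀ {n} → Graph n → Subset n → Set
WeaklyConvex {n} G X =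
  ∀ (a b : Fin n) → a ∈ X → b ∈ X →
    Σ (Walk G a b) λ w → WalkIn X w × IsShortest w

Dominating : ∀ {n} → Graph n → Subset n → Set
Dominating {n} G X = ∀ (v : Fin n) → v ∉ X → ∃ λ (u : Fin n) → u ∈ X × Adj G v u

WCDS : ∀ {n} → Graph n → Subset n → Set
WCDS G X = WeaklyConvex G X × Dominating G X

IsGammaWcon : ∀ {n} → Graph n → ℕ → Set
IsGammaWcon {n} G k =
  (Σ (Subset n) λ X → WCDS G X × Data.Fin.Subset.∣ X ∣ ≡ k) ×
  (∀ (X : Subset n) → WCDS G X → k ≤ Data.Fin.Subset.∣ X ∣)

pathAdj : ∀ n → Fin n → Fin n → Bool
pathAdj n i j = (suc (toℕ i) ≡ᵇ toℕ j) ∨ (suc (toℕ j) ≡ᵇ toℕ i)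

cycleAdj : ∀ n → Fin n → Fin n → Bool
cycleAdj zero    i j = false
cycleAdj (suc k) i j =
  (((suc (toℕ i)) % suc k) ≡ᵇ toℕ j) ∨ (((suc (toℕ j)) % suc k) ≡ᵇ toℕ i)

IsoTo : ∀ {n} → Graph n → (Fin n → Fin n → Bool) → Set
IsoTo {n} G A = Σ (Fin n ⤖ Fin n) λ f →
  ∀ i j → adj G i j ≡ A (Bijection.to f i) (Bijection.to f j)

IsPath : ∀ {n} → Graph n → Set
IsPath {n} G = IsoTo G (pathAdj n)

IsCycle : ∀ {n} → Graph n → Set
IsCycle {n} G = IsoTo G (cycleAdj n)

-- The vertices of degree at least 2 form a weakly convex dominating set: an inner vertex of a
-- shortest path has two distinct neighbours on it, and the neighbour of a leaf is not a leaf
-- (n ≥ 3). As every vertex has degree at least 1, there are at most Σ_v (deg v − 1) = 2m − n of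
-- them. Equality forces all degrees to be 1 or 2, so G is a path or a cycle, and a cycle C_p
-- with p ≤ 6 has the smaller weakly convex dominating set formed by p − 2 consecutive vertices.
-- Conversely, in a path or in a cycle with at least 7 vertices every vertex of degree 2 lies in
-- every weakly convex dominating set X: otherwise a shortest path inside X would close a cycle
-- of length at most 6 through it.
module Submission where

open import Defs renaming (sym to adj-sym; irrefl to adj-irrefl)
open import Data.Nat using (ℕ; zero; suc; _+_; _*_; _∸_; _≤_; _<_; z≤n; s≤s; s≤s⁻¹; _<ᵇ_; _≤ᵇ_; _≡ᵇ_; _%_)
open import Data.Nat.Properties hiding (_≟_)
open import Data.Bool using (Bool; true; false; T; _∧_; _∨_; if_then_else_)
open import Data.Bool.Properties using (T-≡; T-∨; ∨-comm)
open import Data.Fin as Fin using (Fin; zero; suc; toℕ; _≟_; punchIn; punchOut; #_)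
open import Data.Fin.Properties using (toℕ-injective; toℕ<n; toℕ-fromℕ<; toℕ-inject₁; punchIn-punchOut; punchOut-injective; any?; all?; injective⇒≤)
open import Data.Fin.Subset as Subset using (Subset; _∈_; _∉_; ⊤)
open import Data.Fin.Subset.Properties using (_∈?_; ∈⊤; p⊆q⇒∣p∣≤∣q∣; p⊂q⇒∣p∣<∣q∣; ∣⊤∣≡n)
open import Data.List as List using (allFin)
open import Data.List.Properties using (map-cong)
open import Data.Nat.ListAction using () renaming (sum to listSum)
open import Data.Vec using (tabulate; lookup; []; _∷_)
open import Data.Vec.Properties using (lookup∘tabulate; lookup⇒[]=; []=⇒lookup)
open import Data.Product using (Σ; ∃; ∃₂; _×_; _,_; proj₁; proj₂; uncurry)
open import Data.Sum as Sum using (_⊎_; inj₁; inj₂; [_,_]′)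
open import Data.Nat.DivMod using (m%n<n; m<n⇒m%n≡m; n%n≡0)
open import Data.Empty using (⊥)
open import Function using (_∘_; id; _⇔_; mk⇔; Equivalence; _⤖_; Bijection)
open import Relation.Nullary using (¬_; Dec; yes; no; does; ¬?; _×-dec_; _→-dec_; contradiction)
open import Relation.Nullary.Decidable using (map′; T?; True; toWitness; decidable-stable)
open import Relation.Binary.Definitions using (tri<; tri≈; tri>)
open import Relation.Binary.PropositionalEquality
open import Algebra.Properties.CommutativeMonoid.Sum +-0-commutativeMonoid
  using (sum; sum-syntax; sum-remove; ∑-comm; ∑-distrib-+; sum-cong-≗; sum-replicate-zero)

⟦_⟧ : Bool → ℕ
⟦ b ⟧ = if b then 1 else 0

⟦⟧≤1 : ∀ b → ⟦ b ⟧ ≤ 1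
⟦⟧≤1 true  = s≤s z≤n
⟦⟧≤1 false = z≤n

⟦T⟧≡1 : ∀ {b} → T b → ⟦ b ⟧ ≡ 1
⟦T⟧≡1 {true} _ = refl

⟦¬T⟧≡0 : ∀ {b} → ¬ T b → ⟦ b ⟧ ≡ 0
⟦¬T⟧≡0 {true}  ¬t = contradiction _ ¬t
⟦¬T⟧≡0 {false} _  = refl

¬T⇒≡false : ∀ {b} → ¬ T b → b ≡ false
¬T⇒≡false {true}  ¬t = contradiction _ ¬t
¬T⇒≡false {false} _  = refl

sum-mono-≤ : ∀ {n} {f g : Fin n → ℕ} → (∀ i → f i ≤ g i) → sum f ≤ sum g
sum-mono-≤ {zero}  f≤g = z≤n
sum-mono-≤ {suc n} f≤g = +-mono-≤ (f≤g zero) (sum-mono-≤ (f≤g ∘ suc))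

sum-mono-≤-rigid : ∀ {n} {f g : Fin n → ℕ} → (∀ i → f i ≤ g i) → sum g ≤ sum f →
                   ∀ i → f i ≡ g i
sum-mono-≤-rigid {suc n} {f} {g} f≤g Σg≤Σf = pointwise
  where
  head≡ : f zero ≡ g zero
  head≡ = ≤-antisym (f≤g zero)
    (+-cancelʳ-≤ _ _ _ (≤-trans Σg≤Σf (+-monoʳ-≤ (f zero) (sum-mono-≤ (f≤g ∘ suc)))))
  pointwise : ∀ i → f i ≡ g i
  pointwise zero    = head≡
  pointwise (suc i) = sum-mono-≤-rigid (f≤g ∘ suc)
    (+-cancelˡ-≤ (g zero) _ _ (subst (λ x → g zero + _ ≤ x + _) head≡ Σg≤Σf)) i

sum-1 : ∀ {n} → ∑[ i < n ] 1 ≡ n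
sum-1 {zero}  = refl
sum-1 {suc n} = cong suc (sum-1 {n})

≤-sum : ∀ {n} (f : Fin n → ℕ) i → f i ≤ sum f
≤-sum {suc n} f i = subst (f i ≤_) (sym (sum-remove {i = i} f)) (m≤m+n (f i) _)

+≤-sum : ∀ {n} (f : Fin n → ℕ) {i j} → i ≢ j → f i + f j ≤ sum f
+≤-sum {suc n} f {i} {j} i≢j = subst (f i + f j ≤_) (sym (sum-remove {i = i} f))
  (+-monoʳ-≤ (f i) (subst (_≤ sum (f ∘ punchIn i)) (cong f (punchIn-punchOut i≢j))
                           (≤-sum (f ∘ punchIn i) (punchOut i≢j))))

+-+≤-sum : ∀ {n} (f : Fin n → ℕ) {i j k} → i ≢ j → i ≢ k → j ≢ k → f i + (f j + f k) ≤ sum f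
+-+≤-sum {suc n} f {i} {j} {k} i≢j i≢k j≢k = subst (f i + (f j + f k) ≤_) (sym (sum-remove {i = i} f))
  (+-monoʳ-≤ (f i) (subst₂ (λ x y → x + y ≤ sum (f ∘ punchIn i))
                            (cong f (punchIn-punchOut i≢j)) (cong f (punchIn-punchOut i≢k))
    (+≤-sum (f ∘ punchIn i) (j≢k ∘ punchOut-injective i≢j i≢k))))

sum-⟦≟⟧ : ∀ {n} (x : Fin n) → ∑[ j < n ] ⟦ does (j ≟ x) ⟧ ≡ 1
sum-⟦≟⟧ {suc n} zero = cong suc (sum-replicate-zero n)
sum-⟦≟⟧ (suc x) = sum-⟦≟⟧ x

listSum-allFin : ∀ {n} (f : Fin n → ℕ) → listSum (List.map f (allFin n)) ≡ sum f
listSum-allFin f = go f id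
  where
  go : ∀ {n} {A : Set} (f : A → ℕ) (g : Fin n → A) → listSum (List.map f (List.tabulate g)) ≡ sum (f ∘ g)
  go {zero}  f g = refl
  go {suc n} f g = cong (f (g zero) +_) (go f (g ∘ suc))

∈-tabulate⁺ : ∀ {n} (P : Fin n → Bool) {x} → T (P x) → x ∈ tabulate P
∈-tabulate⁺ P {x} t = lookup⇒[]= x (tabulate P) (trans (lookup∘tabulate P x) (Equivalence.to T-≡ t))

∈-tabulate⁻ : ∀ {n} (P : Fin n → Bool) {x} → x ∈ tabulate P → T (P x)
∈-tabulate⁻ P {x} x∈ = Equivalence.from T-≡ (trans (sym (lookup∘tabulate P x)) ([]=⇒lookup x∈))

∣tabulate∣ : ∀ {n} (P : Fin n → Bool) → Subset.∣ tabulate P ∣ ≡ ∑[ i < n ] ⟦ P i ⟧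
∣tabulate∣ {zero}  P = refl
∣tabulate∣ {suc n} P with P zero
... | true  = cong suc (∣tabulate∣ (P ∘ suc))
... | false = ∣tabulate∣ (P ∘ suc)

module GraphBasics {n : ℕ} (G : Graph n) where

  Adj-sym : ∀ {a b} → Adj G a b → Adj G b a
  Adj-sym {a} {b} = subst T (adj-sym G a b)

  Adj-irrefl : ∀ {a} → ¬ Adj G a a
  Adj-irrefl {a} = subst T (adj-irrefl G a)

  Adj⇒≢ : ∀ {a b} → Adj G a b → a ≢ b
  Adj⇒≢ e refl = Adj-irrefl e

  degree : Fin n → ℕ
  degree v = ∑[ j < n ] ⟦ adj G v j ⟧

  degree≥1 : ∀ {v x} → Adj G v x → 1 ≤ degree v
  degree≥1 {v} {x} vx = subst (_≤ degree v) (⟦T⟧≡1 vx) (≤-sum _ x)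

  degree≥2 : ∀ {v x y} → Adj G v x → Adj G v y → x ≢ y → 2 ≤ degree v
  degree≥2 {v} vx vy x≢y = subst₂ (λ a b → a + b ≤ degree v) (⟦T⟧≡1 vx) (⟦T⟧≡1 vy) (+≤-sum _ x≢y)

  degree≥3 : ∀ {v x y z} → Adj G v x → Adj G v y → Adj G v z → x ≢ y → x ≢ z → y ≢ z → 3 ≤ degree v
  degree≥3 {v} vx vy vz x≢y x≢z y≢z =
    subst₂ (λ a b → a + b ≤ degree v) (⟦T⟧≡1 vx) (cong₂ _+_ (⟦T⟧≡1 vy) (⟦T⟧≡1 vz))
           (+-+≤-sum _ x≢y x≢z y≢z)

  private
    upward : Fin n → Fin n → ℕ
    upward i j = ⟦ (toℕ i <ᵇ toℕ j) ∧ adj G i j ⟧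

    both : Fin n → Fin n → Bool → Bool → ℕ
    both i j p q = ⟦ p ∧ adj G i j ⟧ + ⟦ q ∧ adj G j i ⟧

    <ᵇ-false : ∀ {m k} → ¬ (m < k) → (m <ᵇ k) ≡ false
    <ᵇ-false ≮ = ¬T⇒≡false (≮ ∘ <ᵇ⇒< _ _)

    <ᵇ-true : ∀ {m k} → m < k → (m <ᵇ k) ≡ true
    <ᵇ-true < = Equivalence.to T-≡ (<⇒<ᵇ <)

    ⟦adj⟧≡upward+upward : ∀ i j → ⟦ adj G i j ⟧ ≡ upward i j + upward j i
    ⟦adj⟧≡upward+upward i j with <-cmp (toℕ i) (toℕ j)
    ... | tri< i<j _ j≮i =
      sym (trans (cong₂ (both i j) (<ᵇ-true i<j) (<ᵇ-false j≮i)) (+-identityʳ _))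
    ... | tri> i≮j _ j<i =
      sym (trans (cong₂ (both i j) (<ᵇ-false i≮j) (<ᵇ-true j<i)) (cong ⟦_⟧ (adj-sym G j i)))
    ... | tri≈ i≮j i≡j j≮i =
      trans (cong ⟦_⟧ loop) (sym (cong₂ (both i j) (<ᵇ-false i≮j) (<ᵇ-false j≮i)))
      where
      loop : adj G i j ≡ false
      loop = subst (λ k → adj G i k ≡ false) (toℕ-injective i≡j) (adj-irrefl G i)

  handshake : ∑[ v < n ] degree v ≡ 2 * edgeCount G
  handshake = begin
      ∑[ i < n ] ∑[ j < n ] ⟦ adj G i j ⟧
    ≡⟨ sum-cong-≗ (λ i → trans (sum-cong-≗ (⟦adj⟧≡upward+upward i))
                               (∑-distrib-+ (upward i) (λ j → upward j i))) ⟩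
      ∑[ i < n ] (∑[ j < n ] upward i j + ∑[ j < n ] upward j i)
    ≡⟨ ∑-distrib-+ (λ i → ∑[ j < n ] upward i j) (λ i → ∑[ j < n ] upward j i) ⟩
      S + ∑[ i < n ] ∑[ j < n ] upward j i
    ≡⟨ cong (S +_) (∑-comm (λ j i → upward j i)) ⟨
      S + S
    ≡⟨ cong (S +_) (+-identityʳ S) ⟨
      2 * S
    ≡⟨ cong (2 *_) edgeCount≡S ⟨
      2 * edgeCount G
    ∎
    where
    open ≡-Reasoning
    S = ∑[ i < n ] ∑[ j < n ] upward i j
    edgeCount≡S : edgeCount G ≡ S
    edgeCount≡S = trans (cong listSum (map-cong (λ i → listSum-allFin (upward i)) (allFin n)))
                        (listSum-allFin (λ i → ∑[ j < n ] upward i j))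

module Walks {n : ℕ} (G : Graph n) where

  WalkWithin : Subset n → ℕ → Fin n → Fin n → Set
  WalkWithin X L a b = Σ (Walk G a b) λ w → WalkIn X w × wlen w ≤ L

  walkWithin? : ∀ X L a b → Dec (WalkWithin X L a b)
  walkWithin? X L a b with a ∈? X
  walkWithin? X L a b | no a∉X =
    no λ { ([] , a∈X , _) → a∉X a∈X ; (_ ∷ _ , (a∈X , _) , _) → a∉X a∈X }
  walkWithin? X L a b | yes a∈X with a ≟ b
  ... | yes refl = yes ([] , a∈X , z≤n)
  walkWithin? X zero a b | yes a∈X | no a≢b =
    no λ { ([] , _ , _) → a≢b refl ; (_ ∷ _ , _ , ()) }
  walkWithin? X (suc L) a b | yes a∈X | no a≢b
    with any? (λ c → T? (adj G a c) ×-dec walkWithin? X L c b)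
  ... | yes (c , ac , w , w⊆X , w≤L) = yes (ac ∷ w , (a∈X , w⊆X) , s≤s w≤L)
  ... | no ∄c = no λ { ([] , _ , _) → a≢b refl
                     ; (ac ∷ w , (_ , w⊆X) , s≤s w≤L) → ∄c (_ , ac , w , w⊆X , w≤L) }

  walkIn-⊤ : ∀ {a b} (w : Walk G a b) → WalkIn ⊤ w
  walkIn-⊤ []      = ∈⊤
  walkIn-⊤ (_ ∷ w) = ∈⊤ , walkIn-⊤ w

  NoShorterThan : ℕ → Fin n → Fin n → Set
  NoShorterThan L a b = ∀ (w : Walk G a b) → L ≤ wlen w

  noShorterThan? : ∀ L a b → Dec (NoShorterThan L a b)
  noShorterThan? zero    a b = yes λ _ → z≤n
  noShorterThan? (suc L) a b =
    map′ (λ ∄w w → ≰⇒> λ w≤L → ∄w (w , walkIn-⊤ w , w≤L))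
         (λ all≥ (w , _ , w≤L) → 1+n≰n (≤-trans (all≥ w) w≤L))
         (¬? (walkWithin? ⊤ L a b))

  shortestWalk : ∀ {a b} → Walk G a b → Σ (Walk G a b) IsShortest
  shortestWalk w = go (wlen w) w ≤-refl
    where
    go : ∀ L {a b} (w : Walk G a b) → wlen w ≤ L → Σ (Walk G a b) IsShortest
    go zero    w w≤0 = w , λ _ → ≤-trans w≤0 z≤n
    go (suc L) {a} {b} w w≤1+L with walkWithin? ⊤ L a b
    ... | yes (w′ , _ , w′≤L) = go L w′ w′≤L
    ... | no ∄w = w , λ w′ → ≤-trans w≤1+L (≰⇒> λ w′≤L → ∄w (w′ , walkIn-⊤ w′ , w′≤L))

  ShortestWithin : Subset n → Fin n → Fin n → Set
  ShortestWithin X a b = Σ (Walk G a b) λ w → WalkIn X w × IsShortest w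

  shortestWithin : ∀ {X L a b} → WalkWithin X L a b → NoShorterThan L a b → ShortestWithin X a b
  shortestWithin (w , w⊆X , w≤L) L≤ = w , w⊆X , λ w′ → ≤-trans w≤L (L≤ w′)

  IsShortest-tail : ∀ {a c b} (ac : Adj G a c) (w : Walk G c b) → IsShortest (ac ∷ w) → IsShortest w
  IsShortest-tail ac w sh w′ = s≤s⁻¹ (sh (ac ∷ w′))

  IsShortest-noReturn : ∀ {a c d b} (ac : Adj G a c) (cd : Adj G c d) (w : Walk G d b) →
                        IsShortest (ac ∷ (cd ∷ w)) → a ≢ d
  IsShortest-noReturn ac cd w sh refl = 1+n≰n (≤-trans (n≤1+n _) (sh w))

  GeodesicWithin : Subset n → Fin n → Fin n → Set
  GeodesicWithin X a b = Σ (Fin (suc n)) λ L → WalkWithin X (toℕ L) a b × NoShorterThan (toℕ L) a b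

  WeaklyConvexCertificate : Subset n → Set
  WeaklyConvexCertificate X = ∀ a b → a ∈ X → b ∈ X → GeodesicWithin X a b

  weaklyConvexCertificate? : ∀ X → Dec (WeaklyConvexCertificate X)
  weaklyConvexCertificate? X =
    all? λ a → all? λ b → a ∈? X →-dec b ∈? X →-dec
      any? λ L → walkWithin? X (toℕ L) a b ×-dec noShorterThan? (toℕ L) a b

  WeaklyConvexCertificate⇒WeaklyConvex : ∀ {X} → WeaklyConvexCertificate X → WeaklyConvex G X
  WeaklyConvexCertificate⇒WeaklyConvex cert a b a∈ b∈ with cert a b a∈ b∈
  ... | _ , within , noShorter = shortestWithin within noShorter

  dominating? : ∀ X → Dec (Dominating G X)
  dominating? X = all? λ v → ¬? (v ∈? X) →-dec any? λ u → u ∈? X ×-dec T? (adj G v u)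

module _ {m n : ℕ} {G : Graph m} {H : Graph n} (h : Fin m → Fin n)
         (hom : ∀ {u v} → Adj G u v → Adj H (h u) (h v)) where

  mapWalk : ∀ {a b} → Walk G a b → Walk H (h a) (h b)
  mapWalk []       = []
  mapWalk (ac ∷ w) = hom ac ∷ mapWalk w

  wlen-mapWalk : ∀ {a b} (w : Walk G a b) → wlen (mapWalk w) ≡ wlen w
  wlen-mapWalk []      = refl
  wlen-mapWalk (_ ∷ w) = cong suc (wlen-mapWalk w)

  WalkIn-mapWalk : ∀ {X Y} → (∀ {c} → c ∈ X → h c ∈ Y) → ∀ {a b} (w : Walk G a b) →
                   WalkIn X w → WalkIn Y (mapWalk w)
  WalkIn-mapWalk X⇒Y []      a∈        = X⇒Y a∈
  WalkIn-mapWalk X⇒Y (_ ∷ w) (a∈ , w⊆) = X⇒Y a∈ , WalkIn-mapWalk X⇒Y w w⊆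

another : ∀ {n} → 2 ≤ n → (v : Fin n) → ∃ λ u → u ≢ v
another (s≤s (s≤s _)) zero    = suc zero , λ ()
another (s≤s (s≤s _)) (suc v) = zero , λ ()

third : ∀ {n} → 3 ≤ n → (u v : Fin n) → ∃ λ z → z ≢ u × z ≢ v
third (s≤s (s≤s (s≤s _))) zero          zero          = suc zero , (λ ()) , (λ ())
third (s≤s (s≤s (s≤s _))) zero          (suc zero)    = suc (suc zero) , (λ ()) , (λ ())
third (s≤s (s≤s (s≤s _))) zero          (suc (suc _)) = suc zero , (λ ()) , (λ ())
third (s≤s (s≤s (s≤s _))) (suc zero)    zero          = suc (suc zero) , (λ ()) , (λ ())
third (s≤s (s≤s (s≤s _))) (suc (suc _)) zero          = suc zero , (λ ()) , (λ ())
third (s≤s (s≤s (s≤s _))) (suc _)       (suc _)       = zero , (λ ()) , (λ ())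

module NonLeaves {n : ℕ} (G : Graph n) (conn : Connected G) (3≤n : 3 ≤ n) where
  open GraphBasics G
  open Walks G

  neighbour : ∀ v → ∃ λ u → Adj G v u
  neighbour v with another (≤-trans (n≤1+n 2) 3≤n) v
  ... | u , u≢v = first (conn v u)
    where
    first : Walk G v u → ∃ λ u → Adj G v u
    first []       = contradiction refl u≢v
    first (vc ∷ _) = _ , vc

  nonLeaves : Subset n
  nonLeaves = tabulate λ v → 2 ≤ᵇ degree v

  ∈nonLeaves : ∀ {v x y} → Adj G v x → Adj G v y → x ≢ y → v ∈ nonLeaves
  ∈nonLeaves vx vy x≢y = ∈-tabulate⁺ _ (≤⇒≤ᵇ (degree≥2 vx vy x≢y))

  shortest⊆nonLeaves : ∀ {a b} (w : Walk G a b) → IsShortest w →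
                       a ∈ nonLeaves → b ∈ nonLeaves → WalkIn nonLeaves w
  shortest⊆nonLeaves []              _ a∈ b∈ = a∈
  shortest⊆nonLeaves (ab ∷ [])       _ a∈ b∈ = a∈ , b∈
  shortest⊆nonLeaves (ac ∷ (cd ∷ w)) sh a∈ b∈ =
    a∈ , shortest⊆nonLeaves (cd ∷ w) (IsShortest-tail ac (cd ∷ w) sh)
           (∈nonLeaves (Adj-sym ac) cd (IsShortest-noReturn ac cd w sh)) b∈

  nonLeaves-weaklyConvex : WeaklyConvex G nonLeaves
  nonLeaves-weaklyConvex a b a∈ b∈ with shortestWalk (conn a b)
  ... | w , sh = w , shortest⊆nonLeaves w sh a∈ b∈ , sh

  -- A shortest walk from the leaf v to a third vertex z passes through the only neighbour u
  -- of v and continues beyond it, so u has a second neighbour.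
  nonLeaves-dominating : Dominating G nonLeaves
  nonLeaves-dominating v v∉ with neighbour v
  ... | u , vu with third 3≤n v u
  ... | z , z≢v , z≢u with shortestWalk (conn v z)
  ... | [] , _ = contradiction refl z≢v
  ... | vz ∷ [] , _ = contradiction (∈nonLeaves vu vz (z≢u ∘ sym)) v∉
  ... | _∷_ {b = c} vc (cd ∷ w) , sh with c ≟ u
  ...   | yes refl = c , ∈nonLeaves (Adj-sym vc) cd (IsShortest-noReturn vc cd w sh) , vc
  ...   | no c≢u   = contradiction (∈nonLeaves vu vc (c≢u ∘ sym)) v∉

  nonLeaves-wcds : WCDS G nonLeaves
  nonLeaves-wcds = nonLeaves-weaklyConvex , nonLeaves-dominating

  ⟦nonLeaf⟧+1≤degree : ∀ v → ⟦ 2 ≤ᵇ degree v ⟧ + 1 ≤ degree v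
  ⟦nonLeaf⟧+1≤degree v with 2 ≤ᵇ degree v in eq
  ... | true  = ≤ᵇ⇒≤ 2 (degree v) (Equivalence.from T-≡ eq)
  ... | false = degree≥1 (proj₂ (neighbour v))

  ∣nonLeaves∣+n≡∑ : Subset.∣ nonLeaves ∣ + n ≡ ∑[ v < n ] (⟦ 2 ≤ᵇ degree v ⟧ + 1)
  ∣nonLeaves∣+n≡∑ = sym (trans (∑-distrib-+ (λ v → ⟦ 2 ≤ᵇ degree v ⟧) (λ _ → 1))
                              (cong₂ _+_ (sym (∣tabulate∣ (λ v → 2 ≤ᵇ degree v))) (sum-1 {n})))

  ∣nonLeaves∣+n≤2m : Subset.∣ nonLeaves ∣ + n ≤ 2 * edgeCount G
  ∣nonLeaves∣+n≤2m = subst₂ _≤_ (sym ∣nonLeaves∣+n≡∑) handshake (sum-mono-≤ ⟦nonLeaf⟧+1≤degree)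

module _ {n : ℕ} (E : Fin n → Fin n → Bool) where

  OneNeighbour : Fin n → Set
  OneNeighbour v = Σ (Fin n) λ x → T (E v x) × (∀ z → T (E v z) → z ≡ x)

  TwoNeighbours : Fin n → Set
  TwoNeighbours v = Σ (Fin n) λ x → Σ (Fin n) λ y → T (E v x) × T (E v y) × x ≢ y ×
                      (∀ z → T (E v z) → z ≡ x ⊎ z ≡ y)

  Leafless : Set
  Leafless = ∀ v → ¬ OneNeighbour v

  OneOrTwoNeighbours : Fin n → Set
  OneOrTwoNeighbours v = OneNeighbour v ⊎ TwoNeighbours v

  OneNeighbour-unique : ∀ {v a b} → OneNeighbour v → T (E v a) → T (E v b) → a ≡ b
  OneNeighbour-unique (x , _ , only-x) va vb = trans (only-x _ va) (sym (only-x _ vb))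

  OneOrTwoNeighbours-≡ : ∀ {v a b z} → OneOrTwoNeighbours v → T (E v a) → T (E v b) → a ≢ b →
                         T (E v z) → z ≡ a ⊎ z ≡ b
  OneOrTwoNeighbours-≡ (inj₁ one) va vb a≢b _ = contradiction (OneNeighbour-unique one va vb) a≢b
  OneOrTwoNeighbours-≡ {a = a} {b} {z} (inj₂ (x , y , _ , _ , _ , x-or-y)) va vb a≢b vz
    with x-or-y a va | x-or-y b vb | x-or-y z vz
  ... | inj₁ refl | inj₁ refl | _         = contradiction refl a≢b
  ... | inj₂ refl | inj₂ refl | _         = contradiction refl a≢b
  ... | inj₁ refl | inj₂ refl | inj₁ refl = inj₁ refl
  ... | inj₁ refl | inj₂ refl | inj₂ refl = inj₂ refl
  ... | inj₂ refl | inj₁ refl | inj₁ refl = inj₂ refl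
  ... | inj₂ refl | inj₁ refl | inj₂ refl = inj₁ refl

  oneNeighbour? : ∀ {v} → OneOrTwoNeighbours v → Dec (OneNeighbour v)
  oneNeighbour? (inj₁ one)                         = yes one
  oneNeighbour? (inj₂ (x , y , vx , vy , x≢y , _)) = no λ one → x≢y (OneNeighbour-unique one vx vy)

  atMostOneOther⇒OneOrTwoNeighbours : ∀ {v x} → T (E v x) →
                                      (∀ {y z} → T (E v y) → T (E v z) → y ≢ x → z ≢ x → y ≡ z) →
                                      OneOrTwoNeighbours v
  atMostOneOther⇒OneOrTwoNeighbours {v} {x} vx unique with any? (λ y → T? (E v y) ×-dec ¬? (y ≟ x))
  ... | no ∄y = inj₁ (x , vx , λ z vz → decidable-stable (z ≟ x) (λ z≢x → ∄y (z , vz , z≢x)))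
  ... | yes (y , vy , y≢x) = inj₂ (x , y , vx , vy , y≢x ∘ sym , x-or-y)
    where
    x-or-y : ∀ z → T (E v z) → z ≡ x ⊎ z ≡ y
    x-or-y z vz with z ≟ x
    ... | yes z≡x = inj₁ z≡x
    ... | no z≢x  = inj₂ (unique vz vy z≢x y≢x)

  OneOrTwoNeighbours-intro : ∀ {v x} {P Q : Fin n → Set} → T (E v x) →
                             (∀ {a b} → P a → P b → a ≡ b) → (∀ {a b} → Q a → Q b → a ≡ b) →
                             (∀ z → T (E v z) → P z ⊎ Q z) → OneOrTwoNeighbours v
  OneOrTwoNeighbours-intro {v} {x} {P} {Q} vx P-unique Q-unique P-or-Q =
    atMostOneOther⇒OneOrTwoNeighbours vx unique
    where
    unique : ∀ {y z} → T (E v y) → T (E v z) → y ≢ x → z ≢ x → y ≡ z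
    unique {y} {z} vy vz y≢x z≢x with P-or-Q x vx | P-or-Q y vy | P-or-Q z vz
    ... | _       | inj₁ Py | inj₁ Pz = P-unique Py Pz
    ... | _       | inj₂ Qy | inj₂ Qz = Q-unique Qy Qz
    ... | inj₁ Px | inj₁ Py | inj₂ _  = contradiction (P-unique Py Px) y≢x
    ... | inj₂ Qx | inj₁ _  | inj₂ Qz = contradiction (Q-unique Qz Qx) z≢x
    ... | inj₁ Px | inj₂ _  | inj₁ Pz = contradiction (P-unique Pz Px) z≢x
    ... | inj₂ Qx | inj₂ Qy | inj₁ _  = contradiction (Q-unique Qy Qx) y≢x

module Degree≤2 {n : ℕ} (G : Graph n) where
  open GraphBasics G

  degree-OneNeighbour : ∀ {v} → OneNeighbour (adj G) v → degree v ≡ 1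
  degree-OneNeighbour {v} (x , vx , only-x) = trans (sum-cong-≗ pointwise) (sum-⟦≟⟧ x)
    where
    pointwise : ∀ j → ⟦ adj G v j ⟧ ≡ ⟦ does (j ≟ x) ⟧
    pointwise j with j ≟ x
    ... | yes refl = ⟦T⟧≡1 vx
    ... | no j≢x   = ⟦¬T⟧≡0 (j≢x ∘ only-x j)

  degree-TwoNeighbours : ∀ {v} → TwoNeighbours (adj G) v → degree v ≡ 2
  degree-TwoNeighbours {v} (x , y , vx , vy , x≢y , x-or-y) =
    trans (sum-cong-≗ pointwise)
          (trans (∑-distrib-+ (λ j → ⟦ does (j ≟ x) ⟧) _) (cong₂ _+_ (sum-⟦≟⟧ x) (sum-⟦≟⟧ y)))
    where
    pointwise : ∀ j → ⟦ adj G v j ⟧ ≡ ⟦ does (j ≟ x) ⟧ + ⟦ does (j ≟ y) ⟧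
    pointwise j with j ≟ x | j ≟ y
    ... | yes refl | yes refl = contradiction refl x≢y
    ... | yes refl | no _     = ⟦T⟧≡1 vx
    ... | no _     | yes refl = ⟦T⟧≡1 vy
    ... | no j≢x   | no j≢y   = ⟦¬T⟧≡0 ([ j≢x , j≢y ]′ ∘ x-or-y j)

  ⟦nonLeaf⟧+1≡degree : ∀ {v} → OneOrTwoNeighbours (adj G) v → ⟦ 2 ≤ᵇ degree v ⟧ + 1 ≡ degree v
  ⟦nonLeaf⟧+1≡degree (inj₁ one) rewrite degree-OneNeighbour one = refl
  ⟦nonLeaf⟧+1≡degree (inj₂ two) rewrite degree-TwoNeighbours two = refl

  degree≤2⇒OneOrTwoNeighbours : ∀ {v x} → Adj G v x → degree v ≤ 2 → OneOrTwoNeighbours (adj G) v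
  degree≤2⇒OneOrTwoNeighbours {v} {x} vx d≤2 = atMostOneOther⇒OneOrTwoNeighbours (adj G) vx
    λ {y} {z} vy vz y≢x z≢x → decidable-stable (y ≟ z) λ y≢z →
      contradiction (≤-trans (degree≥3 vx vy vz (y≢x ∘ sym) (z≢x ∘ sym) y≢z) d≤2) λ { (s≤s (s≤s ())) }

surjective⇒≤ : ∀ {m n} (h : Fin m → Fin n) → (∀ v → ∃ λ i → h i ≡ v) → n ≤ m
surjective⇒≤ h onto = injective⇒≤ {f = proj₁ ∘ onto}
  λ {u} {v} eq → trans (sym (proj₂ (onto u))) (trans (cong h eq) (proj₂ (onto v)))

module _ {n : ℕ} (G : Graph n) where

  NeighbourClosed : ∀ {m} → (Fin m → Fin n) → Set
  NeighbourClosed h = ∀ i z → Adj G (h i) z → ∃ λ j → h j ≡ z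

  NeighbourClosed⇒surjective : Connected G → ∀ {m} (h : Fin m → Fin n) → NeighbourClosed h →
                               Fin m → ∀ v → ∃ λ i → h i ≡ v
  NeighbourClosed⇒surjective conn h closed i₀ v = go (conn (h i₀) v) (i₀ , refl)
    where
    go : ∀ {a b} → Walk G a b → ∃ (λ i → h i ≡ a) → ∃ λ i → h i ≡ b
    go []       a∈h        = a∈h
    go (ac ∷ w) (i , refl) = go w (closed i _ ac)

module ShortCycles {n : ℕ} (G : Graph n) (conn : Connected G)
                   (locally : ∀ v → OneOrTwoNeighbours (adj G) v) where
  open GraphBasics G

  TwoNeighboursWithin : ∀ {m} → (Fin m → Fin n) → Set
  TwoNeighboursWithin h = ∀ i → ∃₂ λ j k → Adj G (h i) (h j) × Adj G (h i) (h k) × h j ≢ h k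

  TwoNeighboursWithin⇒covering : ∀ {m} (h : Fin (suc m) → Fin n) → TwoNeighboursWithin h →
                                 n ≤ suc m × Leafless (adj G)
  TwoNeighboursWithin⇒covering h two = surjective⇒≤ h onto , noLeaf
    where
    closed : NeighbourClosed G h
    closed i z hiz with two i
    ... | j , k , hij , hik , hj≢hk with OneOrTwoNeighbours-≡ (adj G) (locally (h i)) hij hik hj≢hk hiz
    ...   | inj₁ z≡hj = j , sym z≡hj
    ...   | inj₂ z≡hk = k , sym z≡hk
    onto : ∀ v → ∃ λ i → h i ≡ v
    onto = NeighbourClosed⇒surjective G conn h closed zero
    noLeaf : Leafless (adj G)
    noLeaf v one with onto v
    ... | i , refl with two i
    ...   | j , k , hij , hik , hj≢hk = hj≢hk (OneNeighbour-unique (adj G) one hij hik)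

  triangle : ∀ {a b c} → Adj G a b → Adj G b c → Adj G c a → n ≤ 3 × Leafless (adj G)
  triangle {a} {b} {c} ab bc ca = TwoNeighboursWithin⇒covering (lookup (a ∷ b ∷ c ∷ [])) λ where
    zero             → # 1 , # 2 , ab , Adj-sym ca , Adj⇒≢ bc
    (suc zero)       → # 0 , # 2 , Adj-sym ab , bc , Adj⇒≢ (Adj-sym ca)
    (suc (suc zero)) → # 1 , # 0 , Adj-sym bc , ca , Adj⇒≢ (Adj-sym ab)

  square : ∀ {a b c d} → Adj G a b → Adj G b c → Adj G c d → Adj G d a →
           a ≢ c → b ≢ d → n ≤ 4 × Leafless (adj G)
  square {a} {b} {c} {d} ab bc cd da a≢c b≢d =
    TwoNeighboursWithin⇒covering (lookup (a ∷ b ∷ c ∷ d ∷ [])) λ where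
    zero                   → # 1 , # 3 , ab , Adj-sym da , b≢d
    (suc zero)             → # 0 , # 2 , Adj-sym ab , bc , a≢c
    (suc (suc zero))       → # 1 , # 3 , Adj-sym bc , cd , b≢d
    (suc (suc (suc zero))) → # 2 , # 0 , Adj-sym cd , da , a≢c ∘ sym

  pentagon : ∀ {a b c d e} → Adj G a b → Adj G b c → Adj G c d → Adj G d e → Adj G e a →
             b ≢ e → a ≢ c → b ≢ d → c ≢ e → d ≢ a → n ≤ 5 × Leafless (adj G)
  pentagon {a} {b} {c} {d} {e} ab bc cd de ea b≢e a≢c b≢d c≢e d≢a =
    TwoNeighboursWithin⇒covering (lookup (a ∷ b ∷ c ∷ d ∷ e ∷ [])) λ where
      zero                         → # 1 , # 4 , ab , Adj-sym ea , b≢e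
      (suc zero)                   → # 0 , # 2 , Adj-sym ab , bc , a≢c
      (suc (suc zero))             → # 1 , # 3 , Adj-sym bc , cd , b≢d
      (suc (suc (suc zero)))       → # 2 , # 4 , Adj-sym cd , de , c≢e
      (suc (suc (suc (suc zero)))) → # 3 , # 0 , Adj-sym de , ea , d≢a

  hexagon : ∀ {a b c d e f} → Adj G a b → Adj G b c → Adj G c d → Adj G d e → Adj G e f → Adj G f a →
            b ≢ f → a ≢ c → b ≢ d → c ≢ e → d ≢ f → e ≢ a → n ≤ 6 × Leafless (adj G)
  hexagon {a} {b} {c} {d} {e} {f} ab bc cd de ef fa b≢f a≢c b≢d c≢e d≢f e≢a =
    TwoNeighboursWithin⇒covering (lookup (a ∷ b ∷ c ∷ d ∷ e ∷ f ∷ [])) λ where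
      zero                               → # 1 , # 5 , ab , Adj-sym fa , b≢f
      (suc zero)                         → # 0 , # 2 , Adj-sym ab , bc , a≢c
      (suc (suc zero))                   → # 1 , # 3 , Adj-sym bc , cd , b≢d
      (suc (suc (suc zero)))             → # 2 , # 4 , Adj-sym cd , de , c≢e
      (suc (suc (suc (suc zero))))       → # 3 , # 5 , Adj-sym de , ef , d≢f
      (suc (suc (suc (suc (suc zero))))) → # 4 , # 0 , Adj-sym ef , fa , e≢a

  private
    ∈∉⇒≢ : ∀ {X : Subset n} {a b} → a ∈ X → b ∉ X → a ≢ b
    ∈∉⇒≢ a∈ b∉ refl = b∉ a∈

    upTo6 : ∀ {k} → k ≤ 6 → n ≤ k × Leafless (adj G) → n ≤ 6 × Leafless (adj G)
    upTo6 k≤6 (n≤k , noLeaf) = ≤-trans n≤k k≤6 , noLeaf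

    bothInside : ∀ {X v x y} → WCDS G X → v ∉ X → x ∈ X → y ∈ X →
                 Adj G v x → Adj G v y → x ≢ y → n ≤ 6 × Leafless (adj G)
    bothInside (wc , _) v∉ x∈ y∈ vx vy x≢y with wc _ _ x∈ y∈
    ... | [] , _ , _                             = contradiction refl x≢y
    ... | xy ∷ [] , _ , _                        = upTo6 (m≤m+n 3 3) (triangle vx xy (Adj-sym vy))
    ... | xz ∷ (zy ∷ []) , (_ , z∈ , _) , _      =
      upTo6 (m≤m+n 4 2) (square vx xz zy (Adj-sym vy) (∈∉⇒≢ z∈ v∉ ∘ sym) x≢y)
    ... | _ ∷ (_ ∷ (_ ∷ _)) , _ , sh with sh (Adj-sym vx ∷ (vy ∷ []))
    ...   | s≤s (s≤s ())

    oneInside : ∀ {X v x y} → WCDS G X → v ∉ X → x ∈ X → y ∉ X →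
                Adj G v x → Adj G v y → x ≢ y → n ≤ 6 × Leafless (adj G)
    oneInside {x = x} (wc , dom) v∉ x∈ y∉ vx vy x≢y with dom _ y∉
    ... | w , w∈ , yw with wc _ w x∈ w∈
    ... | [] , _ , _ = upTo6 (m≤m+n 3 3) (triangle vx (Adj-sym yw) (Adj-sym vy))
    ... | xw ∷ [] , _ , _ =
      upTo6 (m≤m+n 4 2) (square vx xw (Adj-sym yw) (Adj-sym vy) (∈∉⇒≢ w∈ v∉ ∘ sym) x≢y)
    ... | xz ∷ (zw ∷ []) , (_ , z∈ , _) , sh =
      upTo6 (m≤m+n 5 1) (pentagon vx xz zw (Adj-sym yw) (Adj-sym vy)
                           x≢y (∈∉⇒≢ z∈ v∉ ∘ sym) x≢w (∈∉⇒≢ z∈ y∉) (∈∉⇒≢ w∈ v∉))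
      where
      x≢w : x ≢ w
      x≢w refl with sh []
      ... | ()
    ... | _∷_ {b = z₁} xz₁ (_∷_ {b = z₂} z₁z₂ (z₂w ∷ [])) , (_ , z₁∈ , z₂∈ , _) , sh =
      hexagon vx xz₁ z₁z₂ z₂w (Adj-sym yw) (Adj-sym vy)
              x≢y (∈∉⇒≢ z₁∈ v∉ ∘ sym) x≢z₂ z₁≢w (∈∉⇒≢ z₂∈ y∉) (∈∉⇒≢ w∈ v∉)
      where
      x≢z₂ : x ≢ z₂
      x≢z₂ refl with sh (z₂w ∷ [])
      ... | s≤s ()
      z₁≢w : z₁ ≢ w
      z₁≢w refl with sh (xz₁ ∷ [])
      ... | s≤s ()
    ... | _ ∷ (_ ∷ (_ ∷ (_ ∷ _))) , _ , sh with sh (Adj-sym vx ∷ (vy ∷ (yw ∷ [])))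
    ...   | s≤s (s≤s (s≤s ()))

    dominatedBy : ∀ {X v a b} → WCDS G X → v ∉ X → a ∈ X → Adj G v a → Adj G v b → a ≢ b →
                  n ≤ 6 × Leafless (adj G)
    dominatedBy {X} {b = b} wcds v∉ a∈ va vb a≢b with b ∈? X
    ... | yes b∈ = bothInside wcds v∉ a∈ b∈ va vb a≢b
    ... | no b∉  = oneInside wcds v∉ a∈ b∉ va vb a≢b

  -- If v ∉ X is dominated by its neighbour x, a shortest path inside X from x to the other
  -- neighbour y (or to a dominator of y) closes a cycle of length at most 6 through v on
  -- which every vertex has two neighbours; as no degree exceeds 2, that cycle is all of G.
  TwoNeighbours∈WCDS : ∀ {X v} → WCDS G X → TwoNeighbours (adj G) v → v ∈ X ⊎ (n ≤ 6 × Leafless (adj G))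
  TwoNeighbours∈WCDS {X} {v} wcds (x , y , vx , vy , x≢y , x-or-y) with v ∈? X
  ... | yes v∈ = inj₁ v∈
  ... | no v∉ with proj₂ wcds v v∉
  ... | u , u∈ , vu with x-or-y u vu
  ...   | inj₁ refl = inj₂ (dominatedBy wcds v∉ u∈ vx vy x≢y)
  ...   | inj₂ refl = inj₂ (dominatedBy wcds v∉ u∈ vy vx (x≢y ∘ sym))

CyclicSucc : ℕ → ℕ → ℕ → Set
CyclicSucc N x y = (x < N × y ≡ suc x) ⊎ (x ≡ N × y ≡ 0)

CyclicSucc-functional : ∀ {N x y y′} → CyclicSucc N x y → CyclicSucc N x y′ → y ≡ y′
CyclicSucc-functional (inj₁ (_ , refl))   (inj₁ (_ , refl))   = refl
CyclicSucc-functional (inj₂ (_ , refl))   (inj₂ (_ , refl))   = refl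
CyclicSucc-functional (inj₁ (x<N , _))    (inj₂ (refl , _))   = contradiction x<N (<-irrefl refl)
CyclicSucc-functional (inj₂ (refl , _))   (inj₁ (x<N , _))    = contradiction x<N (<-irrefl refl)

CyclicSucc-injective : ∀ {N x x′ y} → CyclicSucc N x y → CyclicSucc N x′ y → x ≡ x′
CyclicSucc-injective (inj₁ (_ , refl))   (inj₁ (_ , eq))     = suc-injective eq
CyclicSucc-injective (inj₂ (refl , _))   (inj₂ (refl , _))   = refl
CyclicSucc-injective (inj₁ (_ , refl))   (inj₂ (_ , ()))
CyclicSucc-injective (inj₂ (_ , refl))   (inj₁ (_ , ()))

CyclicSucc-irreflexive : ∀ {N x} → 1 ≤ N → ¬ CyclicSucc N x x
CyclicSucc-irreflexive _   (inj₁ (_ , x≡1+x)) = 1+n≢n (sym x≡1+x)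
CyclicSucc-irreflexive 1≤N (inj₂ (refl , refl)) = contradiction 1≤N λ ()

%≡⇔CyclicSucc : ∀ {N x y} → x ≤ N → (suc x % suc N ≡ y) ⇔ CyclicSucc N x y
%≡⇔CyclicSucc {N} {x} {y} x≤N = mk⇔ (λ { refl → %-CyclicSucc }) (CyclicSucc-functional %-CyclicSucc)
  where
  %-CyclicSucc : CyclicSucc N x (suc x % suc N)
  %-CyclicSucc with m≤n⇒m<n∨m≡n x≤N
  ... | inj₁ x<N  = inj₁ (x<N , m<n⇒m%n≡m (s≤s x<N))
  ... | inj₂ refl = inj₂ (refl , n%n≡0 (suc N))

toℕ≤N : ∀ {N} (a : Fin (suc N)) → toℕ a ≤ N
toℕ≤N a = s≤s⁻¹ (toℕ<n a)

cycleAdj⇔ : ∀ {N} (a b : Fin (suc N)) →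
            T (cycleAdj (suc N) a b) ⇔ (CyclicSucc N (toℕ a) (toℕ b) ⊎ CyclicSucc N (toℕ b) (toℕ a))
cycleAdj⇔ {N} a b = mk⇔
  (Sum.map (from≡ᵇ a b) (from≡ᵇ b a) ∘ Equivalence.to T-∨)
  (Equivalence.from T-∨ ∘ Sum.map (to≡ᵇ a b) (to≡ᵇ b a))
  where
  from≡ᵇ : ∀ a b → T (suc (toℕ a) % suc N ≡ᵇ toℕ b) → CyclicSucc N (toℕ a) (toℕ b)
  from≡ᵇ a b = Equivalence.to (%≡⇔CyclicSucc (toℕ≤N a)) ∘ ≡ᵇ⇒≡ _ _
  to≡ᵇ : ∀ a b → CyclicSucc N (toℕ a) (toℕ b) → T (suc (toℕ a) % suc N ≡ᵇ toℕ b)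
  to≡ᵇ a b = ≡⇒≡ᵇ _ _ ∘ Equivalence.from (%≡⇔CyclicSucc (toℕ≤N a))

pathAdj⇔ : ∀ {n} (a b : Fin n) → T (pathAdj n a b) ⇔ (toℕ b ≡ suc (toℕ a) ⊎ toℕ a ≡ suc (toℕ b))
pathAdj⇔ a b = mk⇔
  (Sum.map (sym ∘ ≡ᵇ⇒≡ _ _) (sym ∘ ≡ᵇ⇒≡ _ _) ∘ Equivalence.to T-∨)
  (Equivalence.from T-∨ ∘ Sum.map (≡⇒≡ᵇ _ _ ∘ sym) (≡⇒≡ᵇ _ _ ∘ sym))

cycle-OneOrTwoNeighbours : ∀ {N} (a : Fin (suc N)) → OneOrTwoNeighbours (cycleAdj (suc N)) a
cycle-OneOrTwoNeighbours {N} a =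
  OneOrTwoNeighbours-intro (cycleAdj (suc N)) {x = next}
    (Equivalence.from (cycleAdj⇔ a next)
      (inj₁ (Equivalence.to (%≡⇔CyclicSucc (toℕ≤N a)) (sym (toℕ-fromℕ< (m%n<n (suc (toℕ a)) (suc N)))))))
    (λ p q → toℕ-injective (CyclicSucc-functional p q))
    (λ p q → toℕ-injective (CyclicSucc-injective p q))
    (λ z → Equivalence.to (cycleAdj⇔ a z))
  where
  next : Fin (suc N)
  next = Fin.fromℕ< (m%n<n (suc (toℕ a)) (suc N))

path-neighbour : ∀ {N} → 1 ≤ N → (a : Fin (suc N)) → ∃ λ x → T (pathAdj (suc N) a x)
path-neighbour (s≤s _) zero    = suc zero , _
path-neighbour (s≤s _) (suc a) =
  Fin.inject₁ a , Equivalence.from (pathAdj⇔ (suc a) _) (inj₂ (cong suc (sym (toℕ-inject₁ a))))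

path-OneOrTwoNeighbours : ∀ {N} → 1 ≤ N → (a : Fin (suc N)) → OneOrTwoNeighbours (pathAdj (suc N)) a
path-OneOrTwoNeighbours {N} 1≤N a =
  OneOrTwoNeighbours-intro (pathAdj (suc N)) (proj₂ (path-neighbour 1≤N a))
    (λ p q → toℕ-injective (trans p (sym q)))
    (λ p q → toℕ-injective (suc-injective (trans (sym p) q)))
    (λ z → Equivalence.to (pathAdj⇔ a z))

path-leaf : ∀ {N} → 1 ≤ N → OneNeighbour (pathAdj (suc N)) zero
path-leaf (s≤s _) =
  suc zero , _ , λ z 0z → toℕ-injective ([ id , (λ ()) ]′ (Equivalence.to (pathAdj⇔ zero z) 0z))

cycleGraph : ∀ N → 1 ≤ N → Graph (suc N)
cycleGraph N 1≤N = record
  { adj    = cycleAdj (suc N)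
  ; sym    = λ a b → ∨-comm (suc (toℕ a) % suc N ≡ᵇ toℕ b) _
  ; irrefl = λ a → ¬T⇒≡false ([ CyclicSucc-irreflexive 1≤N , CyclicSucc-irreflexive 1≤N ]′
                                ∘ Equivalence.to (cycleAdj⇔ a a))
  }

preimage : ∀ {m n} → (Fin m → Fin n) → Subset n → Subset m
preimage h Y = tabulate λ v → does (h v ∈? Y)

∈-preimage⁺ : ∀ {m n} (h : Fin m → Fin n) {Y v} → h v ∈ Y → v ∈ preimage h Y
∈-preimage⁺ h {Y} {v} hv∈ = ∈-tabulate⁺ (λ v → does (h v ∈? Y)) (T-does hv∈)
  where
  T-does : h v ∈ Y → T (does (h v ∈? Y))
  T-does with h v ∈? Y
  ... | yes _ = _
  ... | no hv∉ = hv∉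

∈-preimage⁻ : ∀ {m n} (h : Fin m → Fin n) {Y v} → v ∈ preimage h Y → h v ∈ Y
∈-preimage⁻ h {Y} {v} v∈ with h v ∈? Y | ∈-tabulate⁻ (λ v → does (h v ∈? Y)) v∈
... | yes hv∈ | _ = hv∈

module Isomorphism {n : ℕ} (G : Graph n) (E : Fin n → Fin n → Bool) (iso : IsoTo G E) where

  f : Fin n → Fin n
  f = Bijection.to (proj₁ iso)

  g : Fin n → Fin n
  g a = proj₁ (Bijection.surjective (proj₁ iso) a)

  f∘g : ∀ a → f (g a) ≡ a
  f∘g a = proj₂ (Bijection.surjective (proj₁ iso) a) refl

  ≡g : ∀ {v a} → f v ≡ a → v ≡ g a
  ≡g f[v]≡a = Bijection.injective (proj₁ iso) (trans f[v]≡a (sym (f∘g _)))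

  g∘f : ∀ v → g (f v) ≡ v
  g∘f v = sym (≡g refl)

  Adj⇒E : ∀ {u v} → Adj G u v → T (E (f u) (f v))
  Adj⇒E {u} {v} = subst T (proj₂ iso u v)

  E⇒Adj : ∀ {u a} → T (E (f u) a) → Adj G u (g a)
  E⇒Adj {u} {a} e = subst T (sym (proj₂ iso u (g a))) (subst (T ∘ E (f u)) (sym (f∘g a)) e)

  E⇒Adj-g : ∀ {a b} → T (E a b) → Adj G (g a) (g b)
  E⇒Adj-g {a} {b} e = E⇒Adj (subst (λ x → T (E x b)) (sym (f∘g a)) e)

  OneNeighbour⁻ : ∀ {v} → OneNeighbour E (f v) → OneNeighbour (adj G) v
  OneNeighbour⁻ (x , vx , only-x) = g x , E⇒Adj vx , λ z vz → ≡g (only-x (f z) (Adj⇒E vz))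

  TwoNeighbours⁻ : ∀ {v} → TwoNeighbours E (f v) → TwoNeighbours (adj G) v
  TwoNeighbours⁻ (x , y , vx , vy , x≢y , x-or-y) =
    g x , g y , E⇒Adj vx , E⇒Adj vy , (λ eq → x≢y (trans (sym (f∘g x)) (trans (cong f eq) (f∘g y)))) ,
    λ z vz → Sum.map ≡g ≡g (x-or-y (f z) (Adj⇒E vz))

  OneOrTwoNeighbours⁻ : ∀ {v} → OneOrTwoNeighbours E (f v) → OneOrTwoNeighbours (adj G) v
  OneOrTwoNeighbours⁻ = Sum.map OneNeighbour⁻ TwoNeighbours⁻

module _ {n : ℕ} (G H : Graph n) (iso : IsoTo G (adj H)) where
  open Isomorphism G (adj H) iso

  private
    retarget : ∀ {X a a′ b b′} → a ≡ a′ → b ≡ b′ → (w : Walk G a b) → WalkIn X w →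
               Σ (Walk G a′ b′) λ w′ → WalkIn X w′ × wlen w′ ≡ wlen w
    retarget refl refl w w⊆X = w , w⊆X , refl

  WCDS-preimage : ∀ {Y} → WCDS H Y → WCDS G (preimage f Y)
  WCDS-preimage {Y} (wc , dom) = weaklyConvex , dominating
    where
    fromH : ∀ {a b} → Walk H a b → Walk G (g a) (g b)
    fromH = mapWalk {G = H} {H = G} g E⇒Adj-g
    toH : ∀ {a b} → Walk G a b → Walk H (f a) (f b)
    toH = mapWalk {G = G} {H = H} f Adj⇒E
    g∈ : ∀ {c} → c ∈ Y → g c ∈ preimage f Y
    g∈ {c} c∈ = ∈-preimage⁺ f (subst (_∈ Y) (sym (f∘g c)) c∈)

    weaklyConvex : WeaklyConvex G (preimage f Y)
    weaklyConvex a b a∈ b∈ with wc (f a) (f b) (∈-preimage⁻ f a∈) (∈-preimage⁻ f b∈)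
    ... | w , w⊆Y , w-shortest
      with retarget (g∘f a) (g∘f b) (fromH w) (WalkIn-mapWalk {G = H} {H = G} g E⇒Adj-g g∈ w w⊆Y)
    ...   | w′ , w′⊆X , |w′|≡|gw| = w′ , w′⊆X , λ u → begin
      wlen w′        ≡⟨ trans |w′|≡|gw| (wlen-mapWalk {G = H} {H = G} g E⇒Adj-g w) ⟩
      wlen w         ≤⟨ w-shortest (toH u) ⟩
      wlen (toH u)   ≡⟨ wlen-mapWalk {G = G} {H = H} f Adj⇒E u ⟩
      wlen u         ∎
      where open ≤-Reasoning

    dominating : Dominating G (preimage f Y)
    dominating v v∉ with dom (f v) (v∉ ∘ ∈-preimage⁺ f)
    ... | u , u∈ , vu = g u , g∈ u∈ , E⇒Adj vu

WCDS-byDecision : ∀ {n} (H : Graph n) (X : Subset n) →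
                  True (Walks.weaklyConvexCertificate? H X) → True (Walks.dominating? H X) → WCDS H X
WCDS-byDecision H X wc dom = Walks.WeaklyConvexCertificate⇒WeaklyConvex H (toWitness wc) , toWitness dom

arc : ∀ {n} → Subset n
arc = tabulate λ a → 2 ≤ᵇ toℕ a

-- In C_{N+1} the arc {2, …, N} has length N − 2 and its complement has length 3,
-- so it is geodesic exactly when N ≤ 5.
shortCycle-arc-WCDS : ∀ N → 2 ≤ N → N ≤ 5 → (1≤N : 1 ≤ N) → WCDS (cycleGraph N 1≤N) arc
shortCycle-arc-WCDS 2 _ _ 1≤N = WCDS-byDecision (cycleGraph 2 1≤N) arc _ _
shortCycle-arc-WCDS 3 _ _ 1≤N = WCDS-byDecision (cycleGraph 3 1≤N) arc _ _
shortCycle-arc-WCDS 4 _ _ 1≤N = WCDS-byDecision (cycleGraph 4 1≤N) arc _ _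
shortCycle-arc-WCDS 5 _ _ 1≤N = WCDS-byDecision (cycleGraph 5 1≤N) arc _ _
shortCycle-arc-WCDS 0 () _ _
shortCycle-arc-WCDS 1 (s≤s ()) _ _
shortCycle-arc-WCDS (suc (suc (suc (suc (suc (suc _)))))) _ (s≤s (s≤s (s≤s (s≤s (s≤s ()))))) _

shortCycle-smallerWCDS : ∀ {n} (G : Graph n) → IsCycle G → 3 ≤ n → n ≤ 6 →
                         Σ (Subset n) λ X → WCDS G X × Subset.∣ X ∣ < n
shortCycle-smallerWCDS {suc N} G iso (s≤s 2≤N) (s≤s N≤5) =
  preimage f arc , WCDS-preimage G H iso (shortCycle-arc-WCDS N 2≤N N≤5 1≤N) ,
  subst (Subset.∣ preimage f arc ∣ <_) (∣⊤∣≡n (suc N))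
    (p⊂q⇒∣p∣<∣q∣ ((λ _ → ∈⊤) , g zero , ∈⊤ , g0∉))
  where
  1≤N = ≤-trans (s≤s z≤n) 2≤N
  H = cycleGraph N 1≤N
  open Isomorphism G (cycleAdj (suc N)) iso
  g0∉ : g zero ∉ preimage f arc
  g0∉ g0∈ = ∈-tabulate⁻ (λ a → 2 ≤ᵇ toℕ a) (subst (_∈ arc) (f∘g zero) (∈-preimage⁻ f g0∈))

TraversalStart : ∀ {n} → Graph n → Fin n → Fin n → Set
TraversalStart G s₀ s₁ = (∀ z → Adj G s₀ z → z ≡ s₁) ⊎ (∀ v → TwoNeighbours (adj G) v)

-- Leaving each vertex through its neighbour other than the one we came from, the walk
-- s₀, s₁, … cannot revisit a vertex before all n have been seen: the visited set would
-- otherwise already be closed under neighbours, hence everything by connectivity.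
module Traversal {n : ℕ} (G : Graph n) (conn : Connected G)
                 (locally : ∀ v → OneOrTwoNeighbours (adj G) v)
                 {s₀ s₁ : Fin n} (s₀s₁ : Adj G s₀ s₁) (start : TraversalStart G s₀ s₁) where
  open GraphBasics G

  other : Fin n → Fin n → Fin n
  other v p with locally v
  ... | inj₁ (x , _) = x
  ... | inj₂ (x , y , _) with p ≟ x
  ...   | yes _ = y
  ...   | no _  = x

  other-spec : ∀ {v p q} → Adj G v p → Adj G v q → q ≢ p → Adj G v (other v p) × other v p ≢ p
  other-spec {v} {p} vp vq q≢p with locally v
  ... | inj₁ one = contradiction (OneNeighbour-unique (adj G) one vq vp) q≢p
  ... | inj₂ (x , y , vx , vy , x≢y , _) with p ≟ x
  ...   | yes refl = vy , x≢y ∘ sym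
  ...   | no p≢x   = vx , p≢x ∘ sym

  vertex : ℕ → Fin n
  vertex 0             = s₀
  vertex 1             = s₁
  vertex (suc (suc i)) = other (vertex (suc i)) (vertex i)

  IsPathUpTo : ℕ → Set
  IsPathUpTo t = (∀ i → i < t → Adj G (vertex i) (vertex (suc i))) ×
                 (∀ {i j} → i ≤ t → j ≤ t → vertex i ≡ vertex j → i ≡ j)

  interior : ∀ {t} → IsPathUpTo t → ∀ {i z} → suc (suc i) ≤ t → Adj G (vertex (suc i)) z →
             z ≡ vertex i ⊎ z ≡ vertex (suc (suc i))
  interior (steps , inj) {i} 2+i≤t =
    OneOrTwoNeighbours-≡ (adj G) (locally _) (Adj-sym (steps i (≤-trans (n≤1+n _) 2+i≤t))) (steps (suc i) 2+i≤t)
      (λ eq → <⇒≢ (s≤s (n≤1+n i)) (inj (≤-trans (≤-trans (n≤1+n _) (n≤1+n _)) 2+i≤t) 2+i≤t eq))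

  ClosedUpTo : ℕ → Set
  ClosedUpTo t = ∀ i → i ≤ t → ∀ z → Adj G (vertex i) z → ∃ λ j → j ≤ t × vertex j ≡ z

  ClosedUpTo⇒n≤ : ∀ {t} → ClosedUpTo t → n ≤ suc t
  ClosedUpTo⇒n≤ {t} closed = surjective⇒≤ h (NeighbourClosed⇒surjective G conn h closed′ zero)
    where
    h : Fin (suc t) → Fin n
    h i = vertex (toℕ i)
    closed′ : NeighbourClosed G h
    closed′ i z iz with closed (toℕ i) (toℕ≤N i) z iz
    ... | j , j≤t , eq = Fin.fromℕ< (s≤s j≤t) , trans (cong vertex (toℕ-fromℕ< (s≤s j≤t))) eq

  closedUpTo : ∀ {t} → IsPathUpTo (suc t) →
               (∀ z → Adj G s₀ z → ∃ λ j → j ≤ suc t × vertex j ≡ z) →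
               (∀ z → Adj G (vertex (suc t)) z → ∃ λ j → j ≤ suc t × vertex j ≡ z) →
               ClosedUpTo (suc t)
  closedUpTo path first last zero    _         = first
  closedUpTo path first last (suc i) 1+i≤1+t with m≤n⇒m<n∨m≡n (s≤s⁻¹ 1+i≤1+t)
  ... | inj₂ refl = last
  ... | inj₁ i<t  = λ z iz → [ (λ z≡i   → i , ≤-trans (n≤1+n i) 1+i≤1+t , sym z≡i)
                             , (λ z≡2+i → suc (suc i) , s≤s i<t , sym z≡2+i) ]′ (interior path (s≤s i<t) iz)

  freshNeighbour : ∀ {t} → IsPathUpTo (suc t) → suc (suc t) < n →
                   ∃ λ q → Adj G (vertex (suc t)) q × q ≢ vertex t
  freshNeighbour {t} path 2+t<n = byStart start
    where
    byStart : TraversalStart G s₀ s₁ → ∃ λ q → Adj G (vertex (suc t)) q × q ≢ vertex t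
    byStart (inj₂ noLeaf) with noLeaf (vertex (suc t))
    ... | x , y , cx , cy , x≢y , _ with x ≟ vertex t
    ...   | yes refl = y , cy , x≢y ∘ sym
    ...   | no x≢p   = x , cx , x≢p
    byStart (inj₁ leaf) with any? (λ q → T? (adj G (vertex (suc t)) q) ×-dec ¬? (q ≟ vertex t))
    ... | yes fresh = fresh
    ... | no ∄q = contradiction (ClosedUpTo⇒n≤ (closedUpTo path first last)) (<⇒≱ 2+t<n)
      where
      first : ∀ z → Adj G s₀ z → ∃ λ j → j ≤ suc t × vertex j ≡ z
      first z s₀z = 1 , s≤s z≤n , sym (leaf z s₀z)
      last : ∀ z → Adj G (vertex (suc t)) z → ∃ λ j → j ≤ suc t × vertex j ≡ z
      last z cz = t , n≤1+n t , sym (decidable-stable (z ≟ vertex t) λ z≢p → ∄q (z , cz , z≢p))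

  new≢start : ∀ {t} → IsPathUpTo (suc t) → suc (suc t) < n → 0 < t →
              Adj G (vertex (suc t)) (vertex (suc (suc t))) → vertex (suc (suc t)) ≢ s₀
  new≢start {t} path@(steps , inj) 2+t<n 0<t c~new new≡s₀ = byStart start
    where
    s₀~c : Adj G s₀ (vertex (suc t))
    s₀~c = subst (λ v → Adj G v (vertex (suc t))) new≡s₀ (Adj-sym c~new)
    first : ∀ z → Adj G s₀ z → ∃ λ j → j ≤ suc t × vertex j ≡ z
    first z s₀z with OneOrTwoNeighbours-≡ (adj G) (locally s₀) s₀s₁ s₀~c
                       (λ eq → <⇒≢ (s≤s 0<t) (inj (s≤s z≤n) ≤-refl eq)) s₀z
    ... | inj₁ z≡s₁ = 1 , s≤s z≤n , sym z≡s₁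
    ... | inj₂ z≡c  = suc t , ≤-refl , sym z≡c
    last : ∀ z → Adj G (vertex (suc t)) z → ∃ λ j → j ≤ suc t × vertex j ≡ z
    last z cz with OneOrTwoNeighbours-≡ (adj G) (locally _) (Adj-sym (steps t ≤-refl))
                     (subst (Adj G (vertex (suc t))) new≡s₀ c~new)
                     (λ eq → <⇒≢ 0<t (sym (inj (n≤1+n t) z≤n eq))) cz
    ... | inj₁ z≡p  = t , n≤1+n t , sym z≡p
    ... | inj₂ z≡s₀ = 0 , z≤n , sym z≡s₀
    byStart : TraversalStart G s₀ s₁ → ⊥
    byStart (inj₁ leaf) = <⇒≢ 0<t (sym (suc-injective (inj ≤-refl (s≤s z≤n) (leaf _ s₀~c))))
    byStart (inj₂ _)    = contradiction (ClosedUpTo⇒n≤ (closedUpTo path first last)) (<⇒≱ 2+t<n)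

  new≢earlier : ∀ {t} → IsPathUpTo (suc t) → suc (suc t) < n →
                Adj G (vertex (suc t)) (vertex (suc (suc t))) →
                ∀ {j} → j < t → vertex (suc (suc t)) ≢ vertex j
  new≢earlier path 2+t<n c~new {zero}  0<t = new≢start path 2+t<n 0<t c~new
  new≢earlier {t} path@(_ , inj) 2+t<n c~new {suc j} 1+j<t new≡1+j
    with interior path (≤-trans 1+j<t (n≤1+n t)) (subst (λ v → Adj G v (vertex (suc t))) new≡1+j (Adj-sym c~new))
  ... | inj₁ c≡j   = <⇒≢ j<1+t (sym (inj ≤-refl (<⇒≤ j<1+t) c≡j))
    where
    j<1+t : j < suc t
    j<1+t = ≤-trans (n≤1+n (suc j)) (≤-trans 1+j<t (n≤1+n t))
  ... | inj₂ c≡2+j = <⇒≢ 1+j<t (sym (suc-injective (inj ≤-refl (≤-trans 1+j<t (n≤1+n t)) c≡2+j)))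

  extend : ∀ {t} → IsPathUpTo (suc t) → suc (suc t) < n → IsPathUpTo (suc (suc t))
  extend {t} path@(steps , inj) 2+t<n = steps′ , inj′
    where
    new-spec : Adj G (vertex (suc t)) (vertex (suc (suc t))) × vertex (suc (suc t)) ≢ vertex t
    new-spec with freshNeighbour path 2+t<n
    ... | q , cq , q≢p = other-spec (Adj-sym (steps t ≤-refl)) cq q≢p

    c~new = proj₁ new-spec
    new≢p = proj₂ new-spec

    steps′ : ∀ i → i < suc (suc t) → Adj G (vertex i) (vertex (suc i))
    steps′ i i<2+t with m≤n⇒m<n∨m≡n (s≤s⁻¹ i<2+t)
    ... | inj₁ i<1+t = steps i i<1+t
    ... | inj₂ refl  = c~new

    new≢ : ∀ {j} → j ≤ suc t → vertex (suc (suc t)) ≢ vertex j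
    new≢ j≤1+t with m≤n⇒m<n∨m≡n j≤1+t
    ... | inj₂ refl = Adj⇒≢ c~new ∘ sym
    ... | inj₁ j<1+t with m≤n⇒m<n∨m≡n (s≤s⁻¹ j<1+t)
    ...   | inj₂ refl = new≢p
    ...   | inj₁ j<t  = new≢earlier path 2+t<n c~new j<t

    inj′ : ∀ {i j} → i ≤ suc (suc t) → j ≤ suc (suc t) → vertex i ≡ vertex j → i ≡ j
    inj′ i≤ j≤ eq with m≤n⇒m<n∨m≡n i≤ | m≤n⇒m<n∨m≡n j≤
    ... | inj₁ i< | inj₁ j< = inj (s≤s⁻¹ i<) (s≤s⁻¹ j<) eq
    ... | inj₂ refl | inj₁ j< = contradiction eq (new≢ (s≤s⁻¹ j<))
    ... | inj₁ i< | inj₂ refl = contradiction (sym eq) (new≢ (s≤s⁻¹ i<))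
    ... | inj₂ refl | inj₂ refl = refl

  isPathUpTo : ∀ t → suc t < n → IsPathUpTo (suc t)
  isPathUpTo zero    _     = step , inj
    where
    step : ∀ i → i < 1 → Adj G (vertex i) (vertex (suc i))
    step zero    _         = s₀s₁
    step (suc _) (s≤s ())
    inj : ∀ {i j} → i ≤ 1 → j ≤ 1 → vertex i ≡ vertex j → i ≡ j
    inj {zero}        {zero}        _        _        _  = refl
    inj {zero}        {suc zero}    _        _        eq = contradiction eq (Adj⇒≢ s₀s₁)
    inj {suc zero}    {zero}        _        _        eq = contradiction (sym eq) (Adj⇒≢ s₀s₁)
    inj {suc zero}    {suc zero}    _        _        _  = refl
    inj {suc (suc _)} {_}           (s≤s ()) _        _
    inj {_}           {suc (suc _)} _        (s≤s ()) _
  isPathUpTo (suc t) 2+t<n = extend (isPathUpTo t (≤-trans (n≤1+n _) 2+t<n)) 2+t<n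

injective⇒surjective : ∀ {n} (h : Fin n → Fin n) → (∀ {i j} → h i ≡ h j → i ≡ j) →
                       ∀ v → ∃ λ i → h i ≡ v
injective⇒surjective {suc n} h inj v with any? (λ i → h i ≟ v)
... | yes hit = hit
... | no miss = contradiction (injective⇒≤ {f = h′} h′-injective) 1+n≰n
  where
  h≢v : ∀ i → v ≢ h i
  h≢v i eq = miss (i , sym eq)
  h′ : Fin (suc n) → Fin n
  h′ i = punchOut (h≢v i)
  h′-injective : ∀ {i j} → h′ i ≡ h′ j → i ≡ j
  h′-injective eq = inj (punchOut-injective (h≢v _) (h≢v _) eq)

T-injective : ∀ {x y} → (T x → T y) → (T y → T x) → x ≡ y
T-injective {false} {false} _ _ = refl
T-injective {false} {true}  _ y⇒x = contradiction (y⇒x _) id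
T-injective {true}  {false} x⇒y _ = contradiction (x⇒y _) id
T-injective {true}  {true}  _ _ = refl

IsoTo-byEnumeration : ∀ {n} (G : Graph n) (E : Fin n → Fin n → Bool) (h : Fin n → Fin n) →
                      (∀ {a b} → h a ≡ h b → a ≡ b) → (∀ a b → adj G (h a) (h b) ≡ E a b) → IsoTo G E
IsoTo-byEnumeration {n} G E h h-injective adj≡E = bijection , λ u v →
  trans (cong₂ (adj G) (sym (h∘h⁻¹ u)) (sym (h∘h⁻¹ v))) (adj≡E (h⁻¹ u) (h⁻¹ v))
  where
  h⁻¹ : Fin n → Fin n
  h⁻¹ v = proj₁ (injective⇒surjective h h-injective v)
  h∘h⁻¹ : ∀ v → h (h⁻¹ v) ≡ v
  h∘h⁻¹ v = proj₂ (injective⇒surjective h h-injective v)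
  bijection : Fin n ⤖ Fin n
  bijection = record
    { to        = h⁻¹
    ; cong      = cong h⁻¹
    ; bijective = (λ {u} {v} eq → trans (sym (h∘h⁻¹ u)) (trans (cong h eq) (h∘h⁻¹ v)))
                , λ a → h a , λ {v} eq → h-injective (trans (h∘h⁻¹ v) eq)
    }

module Enumeration {M : ℕ} (G : Graph (suc (suc M))) (1≤M : 1 ≤ M) (conn : Connected G)
                   (locally : ∀ v → OneOrTwoNeighbours (adj G) v)
                   {s₀ s₁ : Fin (suc (suc M))} (s₀s₁ : Adj G s₀ s₁) (start : TraversalStart G s₀ s₁) where
  open GraphBasics G
  open Traversal G conn locally s₀s₁ start

  N : ℕ
  N = suc M

  path : IsPathUpTo N
  path = isPathUpTo M ≤-refl

  steps : ∀ i → i < N → Adj G (vertex i) (vertex (suc i))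
  steps = proj₁ path

  vertex-injective : ∀ {i j} → i ≤ N → j ≤ N → vertex i ≡ vertex j → i ≡ j
  vertex-injective = proj₂ path

  enumerate : Fin (suc N) → Fin (suc N)
  enumerate a = vertex (toℕ a)

  enumerate-injective : ∀ {a b} → enumerate a ≡ enumerate b → a ≡ b
  enumerate-injective {a} {b} = toℕ-injective ∘ vertex-injective (toℕ≤N a) (toℕ≤N b)

  vertex-surjective : ∀ v → ∃ λ i → i ≤ N × vertex i ≡ v
  vertex-surjective v with injective⇒surjective enumerate enumerate-injective v
  ... | a , eq = toℕ a , toℕ≤N a , eq

  last-neighbours : ∀ {z} → Adj G (vertex N) z → z ≡ s₀ ⊎ z ≡ vertex M
  last-neighbours {z} Nz with vertex-surjective z
  ... | zero , _ , refl = inj₁ refl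
  ... | suc j , 1+j≤N , refl with m≤n⇒m<n∨m≡n (s≤s⁻¹ 1+j≤N)
  ...   | inj₂ refl = contradiction refl (Adj⇒≢ Nz)
  ...   | inj₁ j<M with interior path (s≤s j<M) (Adj-sym Nz)
  ...     | inj₁ N≡j   = contradiction (vertex-injective ≤-refl (≤-trans (n≤1+n j) 1+j≤N) N≡j)
                                       (>⇒≢ (≤-trans (s≤s (n≤1+n j)) (s≤s j<M)))
  ...     | inj₂ N≡2+j = inj₂ (cong vertex (suc-injective (sym (vertex-injective ≤-refl (s≤s j<M) N≡2+j))))

  IsoTo-byNeighbours : (E : Fin (suc N) → Fin (suc N) → Bool) (R : ℕ → ℕ → Set) →
                       (∀ a b → T (E a b) ⇔ R (toℕ a) (toℕ b)) →
                       (∀ {i j} → i ≤ N → j ≤ N → R i j → Adj G (vertex i) (vertex j)) →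
                       (∀ {i z} → i ≤ N → Adj G (vertex i) z → ∃ λ j → j ≤ N × R i j × vertex j ≡ z) →
                       IsoTo G E
  IsoTo-byNeighbours E R E⇔R R⇒Adj neighbours =
    IsoTo-byEnumeration G E enumerate enumerate-injective λ a b → T-injective (Adj⇒E a b) (E⇒Adj a b)
    where
    Adj⇒E : ∀ a b → Adj G (enumerate a) (enumerate b) → T (E a b)
    Adj⇒E a b ab with neighbours (toℕ≤N a) ab
    ... | j , j≤N , Rj , eq with vertex-injective j≤N (toℕ≤N b) eq
    ...   | refl = Equivalence.from (E⇔R a b) Rj
    E⇒Adj : ∀ a b → T (E a b) → Adj G (enumerate a) (enumerate b)
    E⇒Adj a b = R⇒Adj (toℕ≤N a) (toℕ≤N b) ∘ Equivalence.to (E⇔R a b)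

  private
    1≢N : 1 ≢ N
    1≢N 1≡N = contradiction (suc-injective (sym 1≡N)) (>⇒≢ 1≤M)

  leaf⇒IsPath : (∀ z → Adj G s₀ z → z ≡ s₁) → IsPath G
  leaf⇒IsPath leaf = IsoTo-byNeighbours (pathAdj (suc N)) R pathAdj⇔ R⇒Adj neighbours
    where
    R : ℕ → ℕ → Set
    R i j = j ≡ suc i ⊎ i ≡ suc j
    R⇒Adj : ∀ {i j} → i ≤ N → j ≤ N → R i j → Adj G (vertex i) (vertex j)
    R⇒Adj _   j≤N (inj₁ refl) = steps _ j≤N
    R⇒Adj i≤N _   (inj₂ refl) = Adj-sym (steps _ i≤N)
    neighbours : ∀ {i z} → i ≤ N → Adj G (vertex i) z → ∃ λ j → j ≤ N × R i j × vertex j ≡ z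
    neighbours {zero} _ s₀z = 1 , s≤s z≤n , inj₁ refl , sym (leaf _ s₀z)
    neighbours {suc i} 1+i≤N iz with m≤n⇒m<n∨m≡n (s≤s⁻¹ 1+i≤N)
    ... | inj₁ i<M with interior path (s≤s i<M) iz
    ...   | inj₁ z≡i   = i , ≤-trans (n≤1+n i) 1+i≤N , inj₂ refl , sym z≡i
    ...   | inj₂ z≡2+i = suc (suc i) , s≤s i<M , inj₁ refl , sym z≡2+i
    neighbours {suc i} _ iz | inj₂ refl with last-neighbours iz
    ...   | inj₁ refl = contradiction (vertex-injective (s≤s z≤n) ≤-refl (sym (leaf _ (Adj-sym iz)))) 1≢N
    ...   | inj₂ z≡M  = M , n≤1+n M , inj₂ refl , sym z≡M

  noLeaf⇒IsCycle : (∀ v → TwoNeighbours (adj G) v) → IsCycle G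
  noLeaf⇒IsCycle noLeaf = IsoTo-byNeighbours (cycleAdj (suc N)) R cycleAdj⇔ R⇒Adj neighbours
    where
    R : ℕ → ℕ → Set
    R i j = CyclicSucc N i j ⊎ CyclicSucc N j i
    wrap : Adj G (vertex N) s₀
    wrap with noLeaf (vertex N)
    ... | x , y , Nx , Ny , x≢y , _ with last-neighbours Nx | last-neighbours Ny
    ...   | inj₁ refl | _         = Nx
    ...   | inj₂ _    | inj₁ refl = Ny
    ...   | inj₂ x≡M  | inj₂ y≡M  = contradiction (trans x≡M (sym y≡M)) x≢y
    succ⇒Adj : ∀ {i j} → CyclicSucc N i j → Adj G (vertex i) (vertex j)
    succ⇒Adj (inj₁ (i<N , refl)) = steps _ i<N
    succ⇒Adj (inj₂ (refl , refl)) = wrap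
    R⇒Adj : ∀ {i j} → i ≤ N → j ≤ N → R i j → Adj G (vertex i) (vertex j)
    R⇒Adj _ _ = [ succ⇒Adj , Adj-sym ∘ succ⇒Adj ]′
    neighbours : ∀ {i z} → i ≤ N → Adj G (vertex i) z → ∃ λ j → j ≤ N × R i j × vertex j ≡ z
    neighbours {zero} _ s₀z
      with OneOrTwoNeighbours-≡ (adj G) (locally s₀) s₀s₁ (Adj-sym wrap)
                                (1≢N ∘ vertex-injective (s≤s z≤n) ≤-refl) s₀z
    ... | inj₁ z≡s₁ = 1 , s≤s z≤n , inj₁ (inj₁ (s≤s z≤n , refl)) , sym z≡s₁
    ... | inj₂ z≡N  = N , ≤-refl , inj₂ (inj₂ (refl , refl)) , sym z≡N
    neighbours {suc i} 1+i≤N iz with m≤n⇒m<n∨m≡n (s≤s⁻¹ 1+i≤N)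
    ... | inj₁ i<M with interior path (s≤s i<M) iz
    ...   | inj₁ z≡i   = i , ≤-trans (n≤1+n i) 1+i≤N , inj₂ (inj₁ (1+i≤N , refl)) , sym z≡i
    ...   | inj₂ z≡2+i = suc (suc i) , s≤s i<M , inj₁ (inj₁ (s≤s i<M , refl)) , sym z≡2+i
    neighbours {suc i} _ iz | inj₂ refl with last-neighbours iz
    ...   | inj₁ z≡s₀ = 0 , z≤n , inj₁ (inj₂ (refl , refl)) , sym z≡s₀
    ...   | inj₂ z≡M  = M , n≤1+n M , inj₂ (inj₁ (≤-refl , refl)) , sym z≡M

IsPath⇒OneOrTwoNeighbours : ∀ {n} (G : Graph n) → 2 ≤ n → IsPath G → ∀ v → OneOrTwoNeighbours (adj G) v
IsPath⇒OneOrTwoNeighbours {suc N} G (s≤s 1≤N) iso v = OneOrTwoNeighbours⁻ (path-OneOrTwoNeighbours 1≤N (f v))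
  where open Isomorphism G (pathAdj (suc N)) iso

IsPath⇒leaf : ∀ {n} (G : Graph n) → 2 ≤ n → IsPath G → ∃ λ v → OneNeighbour (adj G) v
IsPath⇒leaf {suc N} G (s≤s 1≤N) iso =
  g zero , OneNeighbour⁻ (subst (OneNeighbour (pathAdj (suc N))) (sym (f∘g zero)) (path-leaf 1≤N))
  where open Isomorphism G (pathAdj (suc N)) iso

IsCycle⇒OneOrTwoNeighbours : ∀ {n} (G : Graph n) → IsCycle G → ∀ v → OneOrTwoNeighbours (adj G) v
IsCycle⇒OneOrTwoNeighbours {suc N} G iso v = OneOrTwoNeighbours⁻ (cycle-OneOrTwoNeighbours (f v))
  where open Isomorphism G (cycleAdj (suc N)) iso

OneOrTwoNeighbours⇒IsPath⊎IsCycle : ∀ {n} (G : Graph n) → 3 ≤ n → Connected G →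
                                    (∀ v → OneOrTwoNeighbours (adj G) v) →
                                    IsPath G ⊎ (IsCycle G × ∀ v → TwoNeighbours (adj G) v)
OneOrTwoNeighbours⇒IsPath⊎IsCycle {suc (suc (suc _))} G (s≤s (s≤s (s≤s _))) conn locally
  with any? (oneNeighbour? (adj G) ∘ locally)
... | yes (s₀ , s₁ , s₀s₁ , leaf) =
  inj₁ (Enumeration.leaf⇒IsPath G (s≤s z≤n) conn locally s₀s₁ (inj₁ leaf) leaf)
... | no ∄leaf = inj₂ (cycle , noLeaf)
  where
  noLeaf : ∀ v → TwoNeighbours (adj G) v
  noLeaf v = [ (λ one → contradiction (v , one) ∄leaf) , id ]′ (locally v)
  cycle : IsCycle G
  cycle with noLeaf zero
  ... | _ , _ , 0x , _ = Enumeration.noLeaf⇒IsCycle G (s≤s z≤n) conn locally 0x (inj₂ noLeaf) noLeaf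

module Bounds {n : ℕ} (G : Graph n) (conn : Connected G) (3≤n : 3 ≤ n) where
  open GraphBasics G
  open Degree≤2 G
  open NonLeaves G conn 3≤n
  open ShortCycles G conn using (TwoNeighbours∈WCDS)

  γ≤∣nonLeaves∣ : ∀ {k} → IsGammaWcon G k → k ≤ Subset.∣ nonLeaves ∣
  γ≤∣nonLeaves∣ (_ , minimal) = minimal nonLeaves nonLeaves-wcds

  γ≤2m∸n : ∀ {k} → IsGammaWcon G k → k ≤ 2 * edgeCount G ∸ n
  γ≤2m∸n γ = ≤-trans (γ≤∣nonLeaves∣ γ) (m+n≤o⇒m≤o∸n _ ∣nonLeaves∣+n≤2m)

  ∣nonLeaves∣≡2m∸n : (∀ v → OneOrTwoNeighbours (adj G) v) → Subset.∣ nonLeaves ∣ ≡ 2 * edgeCount G ∸ n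
  ∣nonLeaves∣≡2m∸n locally = trans (sym (m+n∸n≡m _ n)) (cong (_∸ n)
    (trans ∣nonLeaves∣+n≡∑ (trans (sum-cong-≗ (⟦nonLeaf⟧+1≡degree ∘ locally)) handshake)))

  tight⇒OneOrTwoNeighbours : ∀ {k} → IsGammaWcon G k → k ≡ 2 * edgeCount G ∸ n →
                             ∀ v → OneOrTwoNeighbours (adj G) v
  tight⇒OneOrTwoNeighbours {k} γ k≡ v =
    degree≤2⇒OneOrTwoNeighbours (proj₂ (neighbour v))
      (subst (_≤ 2) (sum-mono-≤-rigid ⟦nonLeaf⟧+1≤degree ∑degree≤ v) (+-monoˡ-≤ 1 (⟦⟧≤1 _)))
    where
    ∑degree≤ : ∑[ v < n ] degree v ≤ ∑[ v < n ] (⟦ 2 ≤ᵇ degree v ⟧ + 1)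
    ∑degree≤ = begin
      ∑[ v < n ] degree v              ≡⟨ handshake ⟩
      2 * edgeCount G                  ≡⟨ m∸n+n≡m (≤-trans (m≤n+m n _) ∣nonLeaves∣+n≤2m) ⟨
      2 * edgeCount G ∸ n + n          ≡⟨ cong (_+ n) k≡ ⟨
      k + n                            ≤⟨ +-monoˡ-≤ n (γ≤∣nonLeaves∣ γ) ⟩
      Subset.∣ nonLeaves ∣ + n         ≡⟨ ∣nonLeaves∣+n≡∑ ⟩
      ∑[ v < n ] (⟦ 2 ≤ᵇ degree v ⟧ + 1) ∎
      where open ≤-Reasoning

  nonLeaves⊆WCDS : (∀ v → OneOrTwoNeighbours (adj G) v) → ¬ (n ≤ 6 × Leafless (adj G)) →
                   ∀ {X} → WCDS G X → nonLeaves Subset.⊆ X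
  nonLeaves⊆WCDS locally notShort wcds {v} v∈ with locally v
  ... | inj₁ one = contradiction (≤ᵇ⇒≤ 2 _ (∈-tabulate⁻ _ v∈))
                                (subst (λ d → ¬ 2 ≤ d) (sym (degree-OneNeighbour one)) λ { (s≤s ()) })
  ... | inj₂ two = [ id , (λ short → contradiction short notShort) ]′ (TwoNeighbours∈WCDS locally wcds two)

  2m∸n≤γ : ∀ {k} → (∀ v → OneOrTwoNeighbours (adj G) v) → ¬ (n ≤ 6 × Leafless (adj G)) →
           IsGammaWcon G k → 2 * edgeCount G ∸ n ≤ k
  2m∸n≤γ locally notShort ((X , wcds , ∣X∣≡k) , _) =
    subst₂ _≤_ (∣nonLeaves∣≡2m∸n locally) ∣X∣≡k (p⊆q⇒∣p∣≤∣q∣ (nonLeaves⊆WCDS locally notShort wcds))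

  n≤2m∸n : (∀ v → TwoNeighbours (adj G) v) → n ≤ 2 * edgeCount G ∸ n
  n≤2m∸n two = subst₂ _≤_ (∣⊤∣≡n n) (∣nonLeaves∣≡2m∸n (inj₂ ∘ two))
    (p⊆q⇒∣p∣≤∣q∣ {p = ⊤} λ {v} _ → TwoNeighbours⇒∈nonLeaves (two v))
    where
    TwoNeighbours⇒∈nonLeaves : ∀ {v} → TwoNeighbours (adj G) v → v ∈ nonLeaves
    TwoNeighbours⇒∈nonLeaves (_ , _ , vx , vy , x≢y , _) = ∈nonLeaves vx vy x≢y

  tight∧cycle⇒7≤n : ∀ {k} → IsGammaWcon G k → k ≡ 2 * edgeCount G ∸ n → IsCycle G →
                    (∀ v → TwoNeighbours (adj G) v) → 7 ≤ n
  tight∧cycle⇒7≤n γ k≡ cycle two with 7 ≤? n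
  ... | yes 7≤n = 7≤n
  ... | no 7≰n with shortCycle-smallerWCDS G cycle 3≤n (s≤s⁻¹ (≰⇒> 7≰n))
  ...   | X , wcds , ∣X∣<n =
    contradiction (≤-trans (n≤2m∸n two) (≤-trans (≤-reflexive (sym k≡)) (proj₂ γ X wcds))) (<⇒≱ ∣X∣<n)

theorem2p3 : ∀ (n : ℕ) (G : Graph n) → 3 ≤ n → Connected G →
    ∀ (k : ℕ) → IsGammaWcon G k →
      (k ≤ 2 * edgeCount G ∸ n) ×
      ((k ≡ 2 * edgeCount G ∸ n) ⇔ (IsPath G ⊎ (IsCycle G × 7 ≤ n)))
theorem2p3 n G 3≤n conn k γ = γ≤2m∸n γ , mk⇔ tight⇒pathOrLongCycle pathOrLongCycle⇒tight
  where
  open Bounds G conn 3≤n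

  2≤n : 2 ≤ n
  2≤n = ≤-trans (n≤1+n 2) 3≤n

  tight⇒pathOrLongCycle : k ≡ 2 * edgeCount G ∸ n → IsPath G ⊎ (IsCycle G × 7 ≤ n)
  tight⇒pathOrLongCycle k≡ with OneOrTwoNeighbours⇒IsPath⊎IsCycle G 3≤n conn (tight⇒OneOrTwoNeighbours γ k≡)
  ... | inj₁ path          = inj₁ path
  ... | inj₂ (cycle , two) = inj₂ (cycle , tight∧cycle⇒7≤n γ k≡ cycle two)

  pathOrLongCycle⇒tight : IsPath G ⊎ (IsCycle G × 7 ≤ n) → k ≡ 2 * edgeCount G ∸ n
  pathOrLongCycle⇒tight (inj₁ path) =
    ≤-antisym (γ≤2m∸n γ) (2m∸n≤γ (IsPath⇒OneOrTwoNeighbours G 2≤n path) hasLeaf γ)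
    where
    hasLeaf : ¬ (n ≤ 6 × Leafless (adj G))
    hasLeaf (_ , leafless) = uncurry leafless (IsPath⇒leaf G 2≤n path)
  pathOrLongCycle⇒tight (inj₂ (cycle , 7≤n)) =
    ≤-antisym (γ≤2m∸n γ) (2m∸n≤γ (IsCycle⇒OneOrTwoNeighbours G cycle) (λ (n≤6 , _) → <⇒≱ 7≤n n≤6) γ)
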